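{- Let $\vec U$ be a finite universe of separations. If $\vec U$ is distributive and scrupulous, then there exist a set $V$ and a map $f\colon\vec U\to\mathcal{U}(V)$ which is an isomorphism of universes between $\vec U$ and a sub-universe of $\mathcal{U}(V)$, such that for every small atomic element $\vec s\in\vec U$ there is $v\in V$ with $f(\vec s)=(\{v\},V)$.
   Context: A separation system is a poset with an order-reversing involution $\vec s\mapsto\vec s^{\,*}$; a universe of separations is a separation system which is a lattice, with join $\vee$ and meet $\wedge$; it is distributive if this lattice is distributive. An element $\vec s$ is small if $\vec s\le\vec s^{\,*}$; $\vec U$ is scrupulous if $\vec r\le\vec s^{\,*}$ for all small $\vec r,\vec s\in\vec U$. In a finite universe, an element $\vec s$ is atomic if it is not the least element but the only element strictly less than $\vec s$ is the least element. A homomorphism of universes commutes with involutions, joins and meets; an isomorphism of universes is a bijective homomorphism whose inverse is a homomorphism. For a set $V$, $\mathcal{U}(V)$ is the universe of all pairs $(A,B)$ of subsets of $V$ with $A\cup B=V$, with involution $(A,B)^*=(B,A)$, order $(A,B)\le(C,D)$ iff $A\subseteq C$ and $D\subseteq B$, join $(A\cup C,B\cap D)$ and meet $(A\cap C,B\cup D)$; a sub-universe is a subset closed under involution, join and meet. -}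

module Defs where

open import Level using (0ℓ)
open import Data.Nat using (ℕ)
open import Data.Fin using (Fin)
open import Data.Product using (Σ; _×_; _,_; proj₁; proj₂)
open import Data.Sum using (_⊎_)
open import Relation.Nullary using (¬_)
open import Relation.Binary.PropositionalEquality using (_≡_)
open import Relation.Binary.Lattice.Structures using (IsLattice)
open import Relation.Unary using (Pred; _∪_; _∩_; _≐_; ｛_｝; U)
open import Function.Bundles using (_↔_)

record Universe : Set₁ where
  infixr 7 _∧_
  infixr 6 _∨_
  field
    Carrier   : Set
    _≤_       : Carrier → Carrier → Set
    _*        : Carrier → Carrier
    _∨_       : Carrier → Carrier → Carrier
    _∧_       : Carrier → Carrier → Carrier
    isLattice : IsLattice _≡_ _≤_ _∨_ _∧_
    involutive     : ∀ s → (s *) * ≡ s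
    order-reversing : ∀ {r s} → r ≤ s → (s *) ≤ (r *)

module _ (𝑈 : Universe) where
  open Universe 𝑈

  Finite : Set
  Finite = Σ ℕ λ n → Carrier ↔ Fin n

  Distributive : Set
  Distributive = ∀ x y z → x ∧ (y ∨ z) ≡ (x ∧ y) ∨ (x ∧ z)

  Small : Carrier → Set
  Small s = s ≤ (s *)

  Scrupulous : Set
  Scrupulous = ∀ r s → Small r → Small s → r ≤ (s *)

  IsLeast : Carrier → Set
  IsLeast b = ∀ z → b ≤ z

  _<_ : Carrier → Carrier → Set
  r < s = r ≤ s × ¬ (r ≡ s)

  Atomic : Carrier → Set
  Atomic s = ¬ IsLeast s × (∀ r → r < s → IsLeast r)

-- The universe U(V) of set separations of a set V.
-- Subsets of V are predicates; equality of subsets is extensional (_≐_).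

Sep : Set → Set₁
Sep V = Pred V 0ℓ × Pred V 0ℓ

InU : {V : Set} → Sep V → Set
InU {V} (A , B) = ∀ (v : V) → (A ∪ B) v

_≐ˢ_ : {V : Set} → Sep V → Sep V → Set
(A , B) ≐ˢ (C , D) = (A ≐ C) × (B ≐ D)

_*ˢ : {V : Set} → Sep V → Sep V
(A , B) *ˢ = (B , A)

_∨ˢ_ : {V : Set} → Sep V → Sep V → Sep V
(A , B) ∨ˢ (C , D) = (A ∪ C , B ∩ D)

_∧ˢ_ : {V : Set} → Sep V → Sep V → Sep V
(A , B) ∧ˢ (C , D) = (A ∩ C , B ∪ D)

-- f : U → U(V) is an isomorphism of universes between U and a
-- sub-universe of U(V) (namely its image): f lands in U(V), commutes
-- with involution, joins and meets, and is injective (all equalities in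
-- U(V) being equality of pairs of subsets).
record IsEmbedding (𝑈 : Universe) (V : Set) (f : Universe.Carrier 𝑈 → Sep V) : Set₁ where
  open Universe 𝑈
  field
    into      : ∀ s → InU (f s)
    hom-*     : ∀ s → f (s *) ≐ˢ (f s *ˢ)
    hom-∨     : ∀ r s → f (r ∨ s) ≐ˢ (f r ∨ˢ f s)
    hom-∧     : ∀ r s → f (r ∧ s) ≐ˢ (f r ∧ˢ f s)
    injective : ∀ r s → f r ≐ˢ f s → r ≡ s

singletonSep : {V : Set} → V → Sep V
singletonSep v = (｛ v ｝ , U)

-- The points of the representation are the elements j of the universe that are
-- not least, join-prime, and orienting (j ≤ x or j ≤ x* for every x); an element x
-- goes to the separation (↓x, ↓x*) of the set of points.  Meets become
-- intersections, and joins become unions because points are join-prime.  For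
-- injectivity, let r ≰ s and take j minimal with j ≤ r, j ≰ s; by distributivity j
-- is join-prime.  If j is small, scrupulousness makes it orienting, so j is a point
-- in ↓r but not ↓s.  Otherwise take k minimal with k ≤ s*, k ≰ j*: since j* is
-- meet-prime, every x satisfies x ≤ j* or k ≤ x, which makes k an orienting point
-- in ↓s* but not ↓r*.  A small atom is a point, and the only point below itself.
module Submission where

open import Defs
open import Level using (0ℓ)
open import Data.Bool.Properties using (T-irrelevant)
open import Data.Empty using (⊥-elim)
open import Data.Fin.Properties using (all?; inj⇒≟)
open import Data.List using (List; []; _∷_; map; allFin)
open import Data.List.Membership.Propositional using (_∈_)
open import Data.List.Membership.Propositional.Properties using (∈-map⁺; ∈-allFin)
open import Data.List.Relation.Unary.Any using (here; there)
open import Data.Product using (Σ; _×_; _,_; proj₁; proj₂)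
open import Data.Sum using (_⊎_; inj₁; inj₂; [_,_]′)
open import Data.Unit using (tt)
open import Function using (id)
open import Function.Bundles using (Inverse)
open import Function.Properties.Inverse using (↔⇒↣)
open import Relation.Binary.Definitions using (Decidable; DecidableEquality)
open import Relation.Binary.Lattice.Structures using (IsLattice)
open import Relation.Binary.PropositionalEquality using (_≡_; refl; sym; trans; cong; cong₂; subst; module ≡-Reasoning)
open import Relation.Nullary using (¬_; Dec; yes; no)
open import Relation.Nullary.Decidable using (True; toWitness; fromWitness; map′; _×-dec_; _⊎-dec_; _→-dec_; ¬?)
open import Relation.Unary using (Pred; _∪_; _∩_; _⊆_; _≐_; ｛_｝)
open import Relation.Unary.Properties using (≐-refl; ≐-sym; ≐-trans)

module UniverseTheory (𝑈 : Universe) where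
  open Universe 𝑈 hiding (_≤_; _*)
  open IsLattice isLattice
    using (x≤x∨y; y≤x∨y; ∨-least; x∧y≤x; x∧y≤y; ∧-greatest; antisym)
    renaming (refl to ≤-refl; trans to ≤-trans)

  -- Rebound only to give them fixities compatible with those of _∨_ and _∧_.
  infix 4 _≤_
  _≤_ : Carrier → Carrier → Set
  _≤_ = Universe._≤_ 𝑈

  infixl 9 _*
  _* : Carrier → Carrier
  _* = Universe._* 𝑈

  ≤*-swap : ∀ {r s} → r ≤ s * → s ≤ r *
  ≤*-swap {r} {s} r≤s* = subst (_≤ r *) (involutive s) (order-reversing r≤s*)

  *-reflects-≤ : ∀ {r s} → r * ≤ s * → s ≤ r
  *-reflects-≤ {r} {s} r*≤s* = subst (s ≤_) (involutive r) (≤*-swap r*≤s*)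

  *-∨ : ∀ x y → (x ∨ y) * ≡ x * ∧ y *
  *-∨ x y = antisym
    (∧-greatest (order-reversing (x≤x∨y x y)) (order-reversing (y≤x∨y x y)))
    (≤*-swap (∨-least (≤*-swap (x∧y≤x (x *) (y *))) (≤*-swap (x∧y≤y (x *) (y *)))))

  *-∧ : ∀ x y → (x ∧ y) * ≡ x * ∨ y *
  *-∧ x y = begin
    (x ∧ y) *          ≡⟨ cong₂ (λ a b → (a ∧ b) *) (sym (involutive x)) (sym (involutive y)) ⟩
    (x * * ∧ y * *) *  ≡⟨ cong _* (sym (*-∨ (x *) (y *))) ⟩
    (x * ∨ y *) * *    ≡⟨ involutive (x * ∨ y *) ⟩
    x * ∨ y *          ∎
    where open ≡-Reasoning

  ∧*-small : ∀ x → Small 𝑈 (x ∧ x *)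
  ∧*-small x = ≤-trans (x∧y≤y x (x *)) (order-reversing (x∧y≤x x (x *)))

  JoinPrime : Pred Carrier 0ℓ
  JoinPrime j = ∀ x y → j ≤ x ∨ y → j ≤ x ⊎ j ≤ y

  MeetPrime : Pred Carrier 0ℓ
  MeetPrime m = ∀ x y → x ∧ y ≤ m → x ≤ m ⊎ y ≤ m

  Orienting : Pred Carrier 0ℓ
  Orienting j = ∀ x → j ≤ x ⊎ j ≤ x *

  IsPoint : Pred Carrier 0ℓ
  IsPoint j = ¬ IsLeast 𝑈 j × JoinPrime j × Orienting j

  Minimal : Pred Carrier 0ℓ → Pred Carrier 0ℓ
  Minimal P j = P j × (∀ z → P z → z ≤ j → j ≤ z)

  Witness : Carrier → Carrier → Pred Carrier 0ℓ
  Witness a b z = z ≤ a × ¬ z ≤ b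

  witness⇒¬least : ∀ {a b z} → Witness a b z → ¬ IsLeast 𝑈 z
  witness⇒¬least (_ , z≰b) z-least = z≰b (z-least _)

  joinPrime⇒meetPrime* : ∀ {j} → JoinPrime j → MeetPrime (j *)
  joinPrime⇒meetPrime* {j} j-prime x y x∧y≤j*
    with j-prime (x *) (y *) (subst (j ≤_) (*-∧ x y) (≤*-swap x∧y≤j*))
  ... | inj₁ j≤x* = inj₁ (≤*-swap j≤x*)
  ... | inj₂ j≤y* = inj₂ (≤*-swap j≤y*)

  -- Scrupulousness puts j below (x ∧ x*)* = x* ∨ x, and primality chooses a side.
  small-joinPrime⇒orienting : Scrupulous 𝑈 → ∀ {j} → Small 𝑈 j → JoinPrime j → Orienting j
  small-joinPrime⇒orienting scr {j} j-small j-prime x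
    with j-prime (x *) (x * *) (subst (j ≤_) (*-∧ x (x *)) (scr j (x ∧ x *) j-small (∧*-small x)))
  ... | inj₁ j≤x* = inj₂ j≤x*
  ... | inj₂ j≤x** = inj₁ (subst (j ≤_) (involutive x) j≤x**)

  module DecidableOrder (_≤?_ : Decidable _≤_) where

    minimalBelow : ∀ {P : Pred Carrier 0ℓ} → (∀ x → Dec (P x)) → (cs : List Carrier) → ∀ {m} → P m →
      Σ Carrier λ j → P j × j ≤ m × (∀ {z} → z ∈ cs → P z → z ≤ j → j ≤ z)
    minimalBelow P? [] {m} Pm = m , Pm , ≤-refl , λ ()
    minimalBelow P? (c ∷ cs) {m} Pm with P? c ×-dec c ≤? m
    ... | yes (Pc , c≤m) =
      let j , Pj , j≤c , j-min = minimalBelow P? cs Pc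
      in j , Pj , ≤-trans j≤c c≤m , λ { (here refl) _ _ → j≤c ; (there z∈cs) → j-min z∈cs }
    ... | no ¬Pc×c≤m =
      let j , Pj , j≤m , j-min = minimalBelow P? cs Pm
      in j , Pj , j≤m , λ { (here refl) Pc c≤j → ⊥-elim (¬Pc×c≤m (Pc , ≤-trans c≤j j≤m))
                          ; (there z∈cs) → j-min z∈cs }

    minimalOutside⇒joinPrime : Distributive 𝑈 → (B : Pred Carrier 0ℓ) →
      (∀ {u v} → B u → B v → B (u ∨ v)) →
      ∀ {j} → ¬ B j → (∀ z → z ≤ j → ¬ B z → j ≤ z) → JoinPrime j
    minimalOutside⇒joinPrime dist B ∨-closed {j} ¬Bj j-min x y j≤x∨y with j ≤? x | j ≤? y
    ... | yes j≤x | _       = inj₁ j≤x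
    ... | no _    | yes j≤y = inj₂ j≤y
    ... | no j≰x  | no j≰y  =
      ⊥-elim (meet-in-B j≰x λ Bj∧x → meet-in-B j≰y λ Bj∧y →
        ¬Bj (subst B (sym j-split) (∨-closed Bj∧x Bj∧y)))
      where
        j-split : j ≡ (j ∧ x) ∨ (j ∧ y)
        j-split = trans (antisym (∧-greatest ≤-refl j≤x∨y) (x∧y≤x j (x ∨ y))) (dist j x y)

        meet-in-B : ∀ {w} → ¬ j ≤ w → ¬ ¬ B (j ∧ w)
        meet-in-B {w} j≰w ¬Bj∧w = j≰w (≤-trans (j-min (j ∧ w) (x∧y≤x j w) ¬Bj∧w) (x∧y≤y j w))

    minimalWitness⇒joinPrime : Distributive 𝑈 → ∀ {a b j} → Minimal (Witness a b) j → JoinPrime j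
    minimalWitness⇒joinPrime dist {b = b} ((j≤a , j≰b) , j-min) =
      minimalOutside⇒joinPrime dist (_≤ b) ∨-least j≰b
        λ z z≤j z≰b → j-min z (≤-trans z≤j j≤a , z≰b) z≤j

    minimalWitness⇒isPoint : Distributive 𝑈 → ∀ {a b j} → Minimal (Witness a b) j →
      Orienting j → IsPoint j
    minimalWitness⇒isPoint dist j-min j-orienting =
      witness⇒¬least (proj₁ j-min) , minimalWitness⇒joinPrime dist j-min , j-orienting

    minimalWitness-splits : ∀ {a b k} → Minimal (Witness a b) k → MeetPrime b →
      ∀ x → x ≤ b ⊎ k ≤ x
    minimalWitness-splits {b = b} {k} ((k≤a , k≰b) , k-min) b-prime x with x ≤? b
    ... | yes x≤b = inj₁ x≤b
    ... | no x≰b  = inj₂ (≤-trans (k-min (k ∧ x) (≤-trans (x∧y≤x k x) k≤a , k∧x≰b) (x∧y≤x k x))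
                                  (x∧y≤y k x))
      where
        k∧x≰b : ¬ k ∧ x ≤ b
        k∧x≰b k∧x≤b = [ k≰b , x≰b ]′ (b-prime k x k∧x≤b)

    minimalWitness*-orienting : ∀ {a j k} → JoinPrime j → ¬ j ≤ j * →
      Minimal (Witness a (j *)) k → Orienting k
    minimalWitness*-orienting {j = j} {k} j-prime j≰j* k-min x =
      [ (λ x≤j* → inj₂ (≤-trans k≤j (≤*-swap x≤j*))) , inj₁ ]′ (splits x)
      where
        splits : ∀ x → x ≤ j * ⊎ k ≤ x
        splits = minimalWitness-splits k-min (joinPrime⇒meetPrime* j-prime)

        k≤j : k ≤ j
        k≤j = [ (λ j≤j* → ⊥-elim (j≰j* j≤j*)) , id ]′ (splits j)

  module Representation (fin : Finite 𝑈) (dist : Distributive 𝑈) (scr : Scrupulous 𝑈) where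
    open Inverse (proj₂ fin) using (to; from; strictlyInverseʳ)

    _≟_ : DecidableEquality Carrier
    _≟_ = inj⇒≟ (↔⇒↣ (proj₂ fin))

    infix 4 _≤?_
    _≤?_ : Decidable _≤_
    x ≤? y = map′ (λ x∧y≡x → subst (_≤ y) x∧y≡x (x∧y≤y x y))
                  (λ x≤y → antisym (x∧y≤x x y) (∧-greatest ≤-refl x≤y))
                  ((x ∧ y) ≟ x)

    open DecidableOrder _≤?_

    ∀? : ∀ {P : Pred Carrier 0ℓ} → (∀ x → Dec (P x)) → Dec (∀ x → P x)
    ∀? {P} P? = map′ (λ h x → subst P (strictlyInverseʳ x) (h (to x))) (λ h i → h (from i))
                     (all? λ i → P? (from i))

    elements : List Carrier
    elements = map from (allFin (proj₁ fin))

    ∈-elements : ∀ x → x ∈ elements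
    ∈-elements x = subst (_∈ elements) (strictlyInverseʳ x) (∈-map⁺ from (∈-allFin (to x)))

    minimal : ∀ {P : Pred Carrier 0ℓ} → (∀ x → Dec (P x)) → ∀ {a} → P a → Σ Carrier (Minimal P)
    minimal P? Pa =
      let j , Pj , _ , j-min = minimalBelow P? elements Pa
      in j , Pj , λ z → j-min (∈-elements z)

    witness? : ∀ a b z → Dec (Witness a b z)
    witness? a b z = z ≤? a ×-dec ¬? (z ≤? b)

    isPoint? : ∀ j → Dec (IsPoint j)
    isPoint? j = ¬? (∀? (j ≤?_))
      ×-dec ∀? (λ x → ∀? λ y → j ≤? x ∨ y →-dec (j ≤? x ⊎-dec j ≤? y))
      ×-dec ∀? (λ x → j ≤? x ⊎-dec j ≤? x *)

    -- Point-hood is stored as a proof of True, which is irrelevant, so that a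
    -- point is determined by its element of the universe (point-injective).
    Points : Set
    Points = Σ Carrier (λ j → True (isPoint? j))

    point : Points → Carrier
    point = proj₁

    toPoint : ∀ {j} → IsPoint j → Points
    toPoint {j} j-isPoint = j , fromWitness j-isPoint

    point-isPoint : (v : Points) → IsPoint (point v)
    point-isPoint (_ , p) = toWitness p

    point-joinPrime : (v : Points) → JoinPrime (point v)
    point-joinPrime v = proj₁ (proj₂ (point-isPoint v))

    point-orienting : (v : Points) → Orienting (point v)
    point-orienting v = proj₂ (proj₂ (point-isPoint v))

    point-injective : ∀ {v w} → point v ≡ point w → v ≡ w
    point-injective {j , p} {.j , q} refl = cong (j ,_) (T-irrelevant p q)

    ↓_ : Carrier → Pred Points 0ℓ
    ↓ c = λ v → point v ≤ c

    toSep : Carrier → Sep Points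
    toSep c = ↓ c , ↓ (c *)

    ↓-cong : ∀ {r s} → r ≡ s → ↓ r ≐ ↓ s
    ↓-cong refl = ≐-refl

    ↓-∨ : ∀ r s → ↓ (r ∨ s) ≐ ↓ r ∪ ↓ s
    ↓-∨ r s = (λ {v} v≤r∨s → point-joinPrime v r s v≤r∨s)
            , [ (λ v≤r → ≤-trans v≤r (x≤x∨y r s)) , (λ v≤s → ≤-trans v≤s (y≤x∨y r s)) ]′

    ↓-∧ : ∀ r s → ↓ (r ∧ s) ≐ ↓ r ∩ ↓ s
    ↓-∧ r s = (λ v≤r∧s → ≤-trans v≤r∧s (x∧y≤x r s) , ≤-trans v≤r∧s (x∧y≤y r s))
            , (λ (v≤r , v≤s) → ∧-greatest v≤r v≤s)

    separatingPoint : ∀ {r s} → ¬ r ≤ s →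
      Σ Points λ v → Witness r s (point v) ⊎ Witness (s *) (r *) (point v)
    separatingPoint {r} {s} r≰s with minimal (witness? r s) (≤-refl , r≰s)
    ... | j , j-min@((j≤r , j≰s) , _) with j ≤? j *
    ...   | yes j-small =
      toPoint (minimalWitness⇒isPoint dist j-min (small-joinPrime⇒orienting scr j-small j-prime))
      , inj₁ (j≤r , j≰s)
      where j-prime = minimalWitness⇒joinPrime dist j-min
    ...   | no j≰j* with minimal (witness? (s *) (j *)) (≤-refl , λ s*≤j* → j≰s (*-reflects-≤ s*≤j*))
    ...     | k , k-min@((k≤s* , k≰j*) , _) =
      toPoint (minimalWitness⇒isPoint dist k-min (minimalWitness*-orienting j-prime j≰j* k-min))
      , inj₂ (k≤s* , λ k≤r* → k≰j* (≤-trans k≤r* (order-reversing j≤r)))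
      where j-prime = minimalWitness⇒joinPrime dist j-min

    ≤-reflected : ∀ {r s} → toSep r ≐ˢ toSep s → r ≤ s
    ≤-reflected {r} {s} ((↓r⊆↓s , _) , (_ , ↓s*⊆↓r*)) with r ≤? s
    ... | yes r≤s = r≤s
    ... | no r≰s with separatingPoint r≰s
    ...   | v , inj₁ (v≤r , v≰s)   = ⊥-elim (v≰s (↓r⊆↓s {v} v≤r))
    ...   | v , inj₂ (v≤s* , v≰r*) = ⊥-elim (v≰r* (↓s*⊆↓r* {v} v≤s*))

    toSep-isEmbedding : IsEmbedding 𝑈 Points toSep
    toSep-isEmbedding = record
      { into      = λ s v → point-orienting v s
      ; hom-*     = λ s → ≐-refl , ↓-cong (involutive s)
      ; hom-∨     = λ r s → ↓-∨ r s , ≐-trans (↓-cong (*-∨ r s)) (↓-∧ (r *) (s *))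
      ; hom-∧     = λ r s → ↓-∧ r s , ≐-trans (↓-cong (*-∧ r s)) (↓-∨ (r *) (s *))
      ; injective = λ r s (↓r≐↓s , ↓r*≐↓s*) →
          antisym (≤-reflected (↓r≐↓s , ↓r*≐↓s*)) (≤-reflected (≐-sym ↓r≐↓s , ≐-sym ↓r*≐↓s*))
      }

    below-atomic : ∀ {s z} → Atomic 𝑈 s → z ≤ s → z ≡ s ⊎ IsLeast 𝑈 z
    below-atomic {s} {z} (_ , below-least) z≤s with z ≟ s
    ... | yes z≡s = inj₁ z≡s
    ... | no z≢s  = inj₂ (below-least z (z≤s , z≢s))

    atomic⇒joinPrime : ∀ {s} → Atomic 𝑈 s → JoinPrime s
    atomic⇒joinPrime s-atomic@(s-¬least , _) =
      minimalOutside⇒joinPrime dist (IsLeast 𝑈)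
        (λ u-least v-least z → ∨-least (u-least z) (v-least z))
        s-¬least λ z z≤s z-¬least →
          [ (λ z≡s → subst (_≤ z) z≡s ≤-refl) , (λ z-least → ⊥-elim (z-¬least z-least)) ]′
            (below-atomic s-atomic z≤s)

    atom-singleton : ∀ s → Small 𝑈 s → Atomic 𝑈 s → Σ Points λ v → toSep s ≐ˢ singletonSep v
    atom-singleton s s-small s-atomic = v , (↓s⊆｛v｝ , λ { refl → ≤-refl }) , (λ _ → tt) , λ {w} _ → w≤s* w
      where
        s-prime = atomic⇒joinPrime s-atomic
        v = toPoint (proj₁ s-atomic , s-prime , small-joinPrime⇒orienting scr s-small s-prime)

        ↓s⊆｛v｝ : ↓ s ⊆ ｛ v ｝
        ↓s⊆｛v｝ {w} w≤s =
          [ (λ w≡s → point-injective (sym w≡s)) , (λ w-least → ⊥-elim (proj₁ (point-isPoint w) w-least)) ]′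
            (below-atomic s-atomic w≤s)

        w≤s* : ∀ w → point w ≤ s *
        w≤s* w = [ (λ w≤s → ≤-trans w≤s s-small) , id ]′ (point-orienting w s)

lemma4p1 : (𝑈 : Universe) → Finite 𝑈 → Distributive 𝑈 → Scrupulous 𝑈 →
    Σ Set λ V → Σ (Universe.Carrier 𝑈 → Sep V) λ f →
      IsEmbedding 𝑈 V f ×
      (∀ s → Small 𝑈 s → Atomic 𝑈 s → Σ V λ v → f s ≐ˢ singletonSep v)
lemma4p1 𝑈 fin dist scr = Points , toSep , toSep-isEmbedding , atom-singleton
  where open UniverseTheory.Representation 𝑈 fin dist scr
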